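{- For all integers $n\ge0$, $H\ge0$ and $0\le i\le n$, the number $$\tilde\Phi_n^{ -1}\mathrm{d}_n^{H}\cdot\frac1{H!}\frac{\partial^H}{\partial\varepsilon^H}\left(\binom{n+i+\varepsilon}n\binom{2n-i-\varepsilon}n\right)\Big|_{\varepsilon=0}$$ is an integer.
   Context: $\mathrm{d}_n$ is the least common multiple of $1,\dots,n$ ($\mathrm d_0=1$). $\binom xn=x(x-1)\cdots(x-n+1)/n!$. $\tilde\Phi_n=\prod p$ over all primes $p<n$ whose fractional part $\{n/p\}$ lies in $[2/3,1[$ (empty product $=1$). -}

module Defs where

open import Data.Nat as ℕ using (ℕ; zero; suc; _≤?_; _!; NonZero; _%_)
open import Data.Nat.Properties using (_!≢0; m*n≢0)
open import Data.Nat.LCM using (lcm)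
open import Data.Nat.Primality using (prime?)
open import Data.Integer as ℤ using (ℤ; +_)
open import Data.Rational as ℚ using (ℚ; 0ℚ; 1ℚ)
open import Data.List using (List; []; _∷_; map; foldr; upTo)
open import Relation.Nullary using (yes; no)

d : ℕ → ℕ
d n = foldr lcm 1 (map suc (upTo n))

-- factor contributed by a candidate p < n to Φ̃_n:
-- p if p is prime and {n/p} ∈ [2/3,1[ (i.e. 2p ≤ 3·(n mod p)), else 1
phiFactor : ℕ → ℕ → ℕ
phiFactor n zero = 1
phiFactor n (suc q) with prime? (suc q) | 2 ℕ.* suc q ≤? 3 ℕ.* (n % suc q)
... | yes _ | yes _ = suc q
... | _     | _     = 1

tildePhi : ℕ → ℕ
tildePhi n = foldr ℕ._*_ 1 (map (phiFactor n) (upTo n))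

private
  phiFactor-nz : ∀ n p → NonZero (phiFactor n p)
  phiFactor-nz n zero = _
  phiFactor-nz n (suc q) with prime? (suc q) | 2 ℕ.* suc q ≤? 3 ℕ.* (n % suc q)
  ... | yes _ | yes _ = _
  ... | yes _ | no _  = _
  ... | no _  | _     = _

  prod-nz : ∀ n (ps : List ℕ) → NonZero (foldr ℕ._*_ 1 (map (phiFactor n) ps))
  prod-nz n [] = _
  prod-nz n (p ∷ ps) = m*n≢0 _ _ {{phiFactor-nz n p}} {{prod-nz n ps}}

tildePhi-nonZero : ∀ n → NonZero (tildePhi n)
tildePhi-nonZero n = prod-nz n (upTo n)

fromℤ : ℤ → ℚ
fromℤ z = z ℚ./ 1

-- Polynomials in ε over ℚ, as coefficient lists (constant term first)
Poly : Set
Poly = List ℚ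

_⊕_ : Poly → Poly → Poly
[] ⊕ q = q
(a ∷ p) ⊕ [] = a ∷ p
(a ∷ p) ⊕ (b ∷ q) = (a ℚ.+ b) ∷ (p ⊕ q)

scale : ℚ → Poly → Poly
scale c = map (c ℚ.*_)

_⊗_ : Poly → Poly → Poly
[] ⊗ q = []
(a ∷ p) ⊗ q = scale a q ⊕ (0ℚ ∷ (p ⊗ q))

-- binomial polynomial  binom(a + s·ε, n) = (a+sε)(a+sε-1)⋯(a+sε-n+1)/n!
fallingPoly : ℤ → ℤ → ℕ → Poly
fallingPoly a s zero = 1ℚ ∷ []
fallingPoly a s (suc k) =
  fallingPoly a s k ⊗ (fromℤ (a ℤ.- + k) ∷ fromℤ s ∷ [])

binomPoly : ℤ → ℤ → ℕ → Poly
binomPoly a s n = scale (((+ 1) ℚ./ (n !)) {{n !≢0}}) (fallingPoly a s n)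

derivAux : ℕ → Poly → Poly
derivAux k [] = []
derivAux k (c ∷ cs) = (fromℤ (+ k) ℚ.* c) ∷ derivAux (suc k) cs

deriv : Poly → Poly
deriv [] = []
deriv (c ∷ cs) = derivAux 1 cs

derivN : ℕ → Poly → Poly
derivN zero p = p
derivN (suc h) p = deriv (derivN h p)

evalAt0 : Poly → ℚ
evalAt0 [] = 0ℚ
evalAt0 (c ∷ _) = c

taylorCoeff : ℕ → Poly → ℚ
taylorCoeff H P = ((+ 1) ℚ./ (H !)) {{H !≢0}} ℚ.* evalAt0 (derivN H P)

thePoly : ℕ → ℕ → Poly
thePoly n i = binomPoly (+ (n ℕ.+ i)) (+ 1) n
            ⊗ binomPoly (+ (2 ℕ.* n ℕ.∸ i)) (ℤ.- (+ 1)) n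

theNumber : ℕ → ℕ → ℕ → ℚ
theNumber n H i =
  (((+ 1) ℚ./ tildePhi n) {{tildePhi-nonZero n}}) ℚ.* (fromℤ (+ (d n ℕ.^ H)) ℚ.* taylorCoeff H (thePoly n i))

{-# OPTIONS --safe #-}
module Submission where

-- For A = n + i, s = 1 and for A = 2n − i, s = −1, Vandermonde's identity expands
--   n!·C(A + sε, n) = (A + sε)(A − 1 + sε)⋯(A − n + 1 + sε)
-- as Σⱼ (n!/j!)·C(A, n − j)·(sε)(sε − 1)⋯(sε − j + 1). The εʰ-coefficient of the j-th falling
-- factorial times dₙʰ is divisible by dₙ·(j − 1)!, so dₙʰ times the εʰ-coefficient of n!·C(A + sε, n)
-- is divisible by n!, and even by p·n! for a prime p ≤ n with A mod p < n mod p: if p ∤ j then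
-- p ∣ dₙ/j, and if p ∣ j then p ∣ C(A, n − j), the last base-p digit of A being smaller than that
-- of n − j. As (n + i) + (2n − i) = 3n, the condition {n/p} ≥ 2/3 pushes one of the two residues
-- below n mod p. So dₙᴴ times the H-th coefficient of the product is divisible by p·(n!)² for every
-- prime p of Φ̃ₙ, hence by the squarefree Φ̃ₙ times (n!)².

open import Defs
open import Data.Nat using (ℕ; _≤_)
open import Data.Integer using (ℤ)
open import Data.Product using (∃)
open import Relation.Binary.PropositionalEquality using (_≡_)

open import Data.Nat.Base as ℕ using (zero; suc; _!; _<_; _%_; _/_; _∸_; NonZero; z≤n; s≤s)
import Data.Nat.Properties as ℕₚ
open import Data.Integer.Base as ℤ using (+_)
import Data.Integer.Properties as ℤₚ
open import Data.Rational.Base as ℚ using (ℚ; 0ℚ; 1ℚ)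
import Data.Rational.Properties as ℚₚ
import Data.Rational.Unnormalised.Base as ℚᵘ
import Data.Rational.Unnormalised.Properties as ℚᵘₚ
open import Data.List.Base using ([]; _∷_; map; foldr; upTo)
open import Data.List.Membership.Propositional using (_∈_)
open import Data.List.Membership.Propositional.Properties using (∈-map⁺; ∈-upTo⁺; ∈-upTo⁻)
open import Data.List.Relation.Unary.Any using (here; there)
open import Data.List.Relation.Unary.All using (All; []; _∷_)
open import Data.List.Relation.Unary.AllPairs using ([]; _∷_)
open import Data.List.Relation.Unary.Unique.Propositional using (Unique)
open import Data.List.Relation.Unary.Unique.Propositional.Properties using (upTo⁺)
open import Data.Fin.Base using (Fin; toℕ)
open import Data.Fin.Properties using (toℕ≤pred[n])
open import Function.Base using (_∘_)
open import Relation.Binary.PropositionalEquality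
  using (refl; sym; trans; cong; cong₂; subst; subst₂; _≗_; _≢_; module ≡-Reasoning)
open import Data.Sum.Base using (_⊎_; inj₁; inj₂)
open import Data.Product.Base using (_,_; _×_; proj₁)
open import Data.Nat.Divisibility
  using ( _∣_; divides; _∣0; 1∣_; ∣-refl; ∣-trans; ∣1⇒≡1; ∣m+n∣m⇒∣n; n∣m*n; ∣m⇒∣m*n; ∣n⇒∣m*n
        ; ∣⇒≤; *-monoˡ-∣; *-pres-∣; *-cancelʳ-∣)
open import Data.Integer.Divisibility.Signed as ℤᵈ
  using (∣ᵤ⇒∣; ∣m∣n⇒∣m+n) renaming (_∣_ to _∣ᶻ_)
open import Data.Nat.LCM using (lcm; m∣lcm[m,n]; n∣lcm[m,n])
open import Data.Nat.ListAction using (product)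
open import Data.Nat.DivMod using (m≡m%n+[m/n]*n; m%n<n; m*n≤o⇒[o∸m*n]%n≡o%n)
open import Data.Nat.Primality using (Prime; prime?; euclidsLemma; prime⇒nonZero; prime⇒irreducible; ¬prime[1])
open import Relation.Nullary.Negation using (¬_; contradiction)
open import Relation.Nullary.Decidable using (yes; no)
import Data.Integer.Tactic.RingSolver as ℤ-Solver
import Data.Nat.Tactic.RingSolver as ℕ-Solver
open import Data.Rational.Solver using (module +-*-Solver)
open import Data.Nat.Combinatorics using (_C_; nCk+nC[k+1]≡[n+1]C[k+1]; nC1≡n; k>n⇒nCk≡0)
open import Algebra.Properties.Semiring.Sum ℤₚ.+-*-semiring
  using (sum-syntax; sum-cong-≗; sum-replicate-zero; ∑-distrib-+; *-distribˡ-sum)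

module Convolution {A : Set} (_+_ _*_ : A → A → A) where

  infixl 7 _⋆_

  _⋆_ : (ℕ → A) → (ℕ → A) → ℕ → A
  (f ⋆ g) zero    = f 0 * g 0
  (f ⋆ g) (suc h) = (f 0 * g (suc h)) + ((f ∘ suc) ⋆ g) h

  ⋆-cong : ∀ {f f′ g g′} → f ≗ f′ → g ≗ g′ → f ⋆ g ≗ f′ ⋆ g′
  ⋆-cong f≗f′ g≗g′ zero    = cong₂ _*_ (f≗f′ 0) (g≗g′ 0)
  ⋆-cong f≗f′ g≗g′ (suc h) =
    cong₂ _+_ (cong₂ _*_ (f≗f′ 0) (g≗g′ (suc h))) (⋆-cong (f≗f′ ∘ suc) g≗g′ h)

open Convolution ℤ._+_ ℤ._*_ using () renaming (_⋆_ to _⋆ᶻ_)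
open Convolution ℚ._+_ ℚ._*_ using () renaming (_⋆_ to _⋆ᵠ_; ⋆-cong to ⋆ᵠ-cong)

toℚᵘ-fromℤ : ∀ z → ℚ.toℚᵘ (fromℤ z) ℚᵘ.≃ ℚᵘ.mkℚᵘ z 0
toℚᵘ-fromℤ z = ℚₚ.toℚᵘ-fromℚᵘ (ℚᵘ.mkℚᵘ z 0)

fromℤ-+ : ∀ x y → fromℤ (x ℤ.+ y) ≡ fromℤ x ℚ.+ fromℤ y
fromℤ-+ x y = ℚₚ.toℚᵘ-injective (begin
  ℚ.toℚᵘ (fromℤ (x ℤ.+ y))
    ≈⟨ toℚᵘ-fromℤ (x ℤ.+ y) ⟩
  ℚᵘ.mkℚᵘ (x ℤ.+ y) 0
    ≈⟨ ℚᵘ.*≡* (cong (ℤ._* + 1) (sym (cong₂ ℤ._+_ (ℤₚ.*-identityʳ x) (ℤₚ.*-identityʳ y)))) ⟩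
  ℚᵘ.mkℚᵘ x 0 ℚᵘ.+ ℚᵘ.mkℚᵘ y 0
    ≈⟨ ℚᵘₚ.+-cong (toℚᵘ-fromℤ x) (toℚᵘ-fromℤ y) ⟨
  ℚ.toℚᵘ (fromℤ x) ℚᵘ.+ ℚ.toℚᵘ (fromℤ y)
    ≈⟨ ℚₚ.toℚᵘ-homo-+ (fromℤ x) (fromℤ y) ⟨
  ℚ.toℚᵘ (fromℤ x ℚ.+ fromℤ y) ∎)
  where open ℚᵘₚ.≃-Reasoning

fromℤ-* : ∀ x y → fromℤ (x ℤ.* y) ≡ fromℤ x ℚ.* fromℤ y
fromℤ-* x y = ℚₚ.toℚᵘ-injective (begin
  ℚ.toℚᵘ (fromℤ (x ℤ.* y))
    ≈⟨ toℚᵘ-fromℤ (x ℤ.* y) ⟩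
  ℚᵘ.mkℚᵘ x 0 ℚᵘ.* ℚᵘ.mkℚᵘ y 0
    ≈⟨ ℚᵘₚ.*-cong (toℚᵘ-fromℤ x) (toℚᵘ-fromℤ y) ⟨
  ℚ.toℚᵘ (fromℤ x) ℚᵘ.* ℚ.toℚᵘ (fromℤ y)
    ≈⟨ ℚₚ.toℚᵘ-homo-* (fromℤ x) (fromℤ y) ⟨
  ℚ.toℚᵘ (fromℤ x ℚ.* fromℤ y) ∎)
  where open ℚᵘₚ.≃-Reasoning

1/n*n≡1 : ∀ n .{{_ : NonZero n}} → ((+ 1) ℚ./ n) ℚ.* fromℤ (+ n) ≡ 1ℚ
1/n*n≡1 (suc k) = ℚₚ.toℚᵘ-injective (begin
  ℚ.toℚᵘ (((+ 1) ℚ./ suc k) ℚ.* fromℤ (+ suc k))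
    ≈⟨ ℚₚ.toℚᵘ-homo-* ((+ 1) ℚ./ suc k) (fromℤ (+ suc k)) ⟩
  ℚ.toℚᵘ ((+ 1) ℚ./ suc k) ℚᵘ.* ℚ.toℚᵘ (fromℤ (+ suc k))
    ≈⟨ ℚᵘₚ.*-cong (ℚₚ.toℚᵘ-fromℚᵘ (ℚᵘ.mkℚᵘ (+ 1) k)) (toℚᵘ-fromℤ (+ suc k)) ⟩
  ℚᵘ.mkℚᵘ (+ 1) k ℚᵘ.* ℚᵘ.mkℚᵘ (+ suc k) 0
    ≈⟨ ℚᵘ.*≡* (cong (+_ ∘ suc) (normalise k)) ⟩
  ℚᵘ.1ℚᵘ ∎)
  where
  open ℚᵘₚ.≃-Reasoning
  normalise : ∀ k → (k ℕ.+ 0) ℕ.* 1 ≡ k ℕ.* 1 ℕ.+ 0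
  normalise = ℕ-Solver.solve-∀

1/n*[z*n]≡z : ∀ n .{{_ : NonZero n}} z → ((+ 1) ℚ./ n) ℚ.* fromℤ (z ℤ.* + n) ≡ fromℤ z
1/n*[z*n]≡z n z = begin
  1/n ℚ.* fromℤ (z ℤ.* + n)          ≡⟨ cong (1/n ℚ.*_) (fromℤ-* z (+ n)) ⟩
  1/n ℚ.* (fromℤ z ℚ.* fromℤ (+ n))  ≡⟨ swap 1/n (fromℤ z) (fromℤ (+ n)) ⟩
  fromℤ z ℚ.* (1/n ℚ.* fromℤ (+ n))  ≡⟨ cong (fromℤ z ℚ.*_) (1/n*n≡1 n) ⟩
  fromℤ z ℚ.* 1ℚ                     ≡⟨ ℚₚ.*-identityʳ (fromℤ z) ⟩
  fromℤ z                            ∎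
  where
  open ≡-Reasoning
  open +-*-Solver
  1/n : ℚ
  1/n = (+ 1) ℚ./ n
  swap : ∀ a b c → a ℚ.* (b ℚ.* c) ≡ b ℚ.* (a ℚ.* c)
  swap = solve 3 (λ a b c → a :* (b :* c) := b :* (a :* c)) refl

pos-^ : ∀ m h → + (m ℕ.^ h) ≡ (+ m) ℤ.^ h
pos-^ m zero    = refl
pos-^ m (suc h) = trans (ℤₚ.pos-* m (m ℕ.^ h)) (cong (+ m ℤ.*_) (pos-^ m h))

coeff : Poly → ℕ → ℚ
coeff []       _       = 0ℚ
coeff (c ∷ cs) zero    = c
coeff (c ∷ cs) (suc h) = coeff cs h

coeff-⊕ : ∀ p q → coeff (p ⊕ q) ≗ λ h → coeff p h ℚ.+ coeff q h
coeff-⊕ []      q       h       = sym (ℚₚ.+-identityˡ (coeff q h))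
coeff-⊕ (a ∷ p) []      h       = sym (ℚₚ.+-identityʳ (coeff (a ∷ p) h))
coeff-⊕ (a ∷ p) (b ∷ q) zero    = refl
coeff-⊕ (a ∷ p) (b ∷ q) (suc h) = coeff-⊕ p q h

coeff-scale : ∀ c p → coeff (scale c p) ≗ λ h → c ℚ.* coeff p h
coeff-scale c []      h       = sym (ℚₚ.*-zeroʳ c)
coeff-scale c (a ∷ p) zero    = refl
coeff-scale c (a ∷ p) (suc h) = coeff-scale c p h

0⋆ᵠg≗0 : ∀ g → (λ _ → 0ℚ) ⋆ᵠ g ≗ λ _ → 0ℚ
0⋆ᵠg≗0 g zero    = ℚₚ.*-zeroˡ (g 0)
0⋆ᵠg≗0 g (suc h) =
  trans (cong₂ ℚ._+_ (ℚₚ.*-zeroˡ (g (suc h))) (0⋆ᵠg≗0 g h)) (ℚₚ.+-identityˡ 0ℚ)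

coeff-⊗ : ∀ p q → coeff (p ⊗ q) ≗ coeff p ⋆ᵠ coeff q
coeff-⊗ []      q h       = sym (0⋆ᵠg≗0 (coeff q) h)
coeff-⊗ (a ∷ p) q zero    = begin
  coeff (scale a q ⊕ (0ℚ ∷ (p ⊗ q))) 0  ≡⟨ coeff-⊕ (scale a q) (0ℚ ∷ (p ⊗ q)) 0 ⟩
  coeff (scale a q) 0 ℚ.+ 0ℚ            ≡⟨ ℚₚ.+-identityʳ _ ⟩
  coeff (scale a q) 0                   ≡⟨ coeff-scale a q 0 ⟩
  a ℚ.* coeff q 0                       ∎
  where open ≡-Reasoning
coeff-⊗ (a ∷ p) q (suc h) = trans (coeff-⊕ (scale a q) (0ℚ ∷ (p ⊗ q)) (suc h))
  (cong₂ ℚ._+_ (coeff-scale a q (suc h)) (coeff-⊗ p q h))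

⋆ᵠ-scale : ∀ u v f g →
  (λ h → u ℚ.* f h) ⋆ᵠ (λ h → v ℚ.* g h) ≗ λ h → (u ℚ.* v) ℚ.* (f ⋆ᵠ g) h
⋆ᵠ-scale u v f g zero    = interchange u (f 0) v (g 0)
  where
  open +-*-Solver
  interchange : ∀ u x v y → (u ℚ.* x) ℚ.* (v ℚ.* y) ≡ (u ℚ.* v) ℚ.* (x ℚ.* y)
  interchange = solve 4 (λ u x v y → (u :* x) :* (v :* y) := (u :* v) :* (x :* y)) refl
⋆ᵠ-scale u v f g (suc h) = trans
  (cong ((u ℚ.* f 0) ℚ.* (v ℚ.* g (suc h)) ℚ.+_) (⋆ᵠ-scale u v (f ∘ suc) g h))
  (factor u (f 0) v (g (suc h)) (((f ∘ suc) ⋆ᵠ g) h))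
  where
  open +-*-Solver
  factor : ∀ u x v y z →
    (u ℚ.* x) ℚ.* (v ℚ.* y) ℚ.+ (u ℚ.* v) ℚ.* z ≡ (u ℚ.* v) ℚ.* (x ℚ.* y ℚ.+ z)
  factor = solve 5 (λ u x v y z → (u :* x) :* (v :* y) :+ (u :* v) :* z := (u :* v) :* (x :* y :+ z)) refl

coeff-derivAux : ∀ k cs j → coeff (derivAux k cs) j ≡ fromℤ (+ (k ℕ.+ j)) ℚ.* coeff cs j
coeff-derivAux k []       j       = sym (ℚₚ.*-zeroʳ (fromℤ (+ (k ℕ.+ j))))
coeff-derivAux k (c ∷ cs) zero    = cong (λ m → fromℤ (+ m) ℚ.* c) (sym (ℕₚ.+-identityʳ k))
coeff-derivAux k (c ∷ cs) (suc j) = trans (coeff-derivAux (suc k) cs j)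
  (cong (λ m → fromℤ (+ m) ℚ.* coeff cs j) (sym (ℕₚ.+-suc k j)))

coeff-deriv : ∀ p j → coeff (deriv p) j ≡ fromℤ (+ suc j) ℚ.* coeff p (suc j)
coeff-deriv []       j = sym (ℚₚ.*-zeroʳ (fromℤ (+ suc j)))
coeff-deriv (c ∷ cs) j = coeff-derivAux 1 cs j

coeff-derivN : ∀ H p j →
  fromℤ (+ (j !)) ℚ.* coeff (derivN H p) j ≡ fromℤ (+ ((j ℕ.+ H) !)) ℚ.* coeff p (j ℕ.+ H)
coeff-derivN zero    p j = cong (λ m → fromℤ (+ (m !)) ℚ.* coeff p m) (sym (ℕₚ.+-identityʳ j))
coeff-derivN (suc H) p j = begin
  fromℤ (+ (j !)) ℚ.* coeff (deriv (derivN H p)) j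
    ≡⟨ cong (fromℤ (+ (j !)) ℚ.*_) (coeff-deriv (derivN H p) j) ⟩
  fromℤ (+ (j !)) ℚ.* (fromℤ (+ suc j) ℚ.* coeff (derivN H p) (suc j))
    ≡⟨ ℚₚ.*-assoc (fromℤ (+ (j !))) (fromℤ (+ suc j)) _ ⟨
  (fromℤ (+ (j !)) ℚ.* fromℤ (+ suc j)) ℚ.* coeff (derivN H p) (suc j)
    ≡⟨ cong (ℚ._* coeff (derivN H p) (suc j)) j!*[1+j]≡[1+j]! ⟩
  fromℤ (+ (suc j !)) ℚ.* coeff (derivN H p) (suc j)
    ≡⟨ coeff-derivN H p (suc j) ⟩
  fromℤ (+ ((suc j ℕ.+ H) !)) ℚ.* coeff p (suc j ℕ.+ H)
    ≡⟨ cong (λ m → fromℤ (+ (m !)) ℚ.* coeff p m) (sym (ℕₚ.+-suc j H)) ⟩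
  fromℤ (+ ((j ℕ.+ suc H) !)) ℚ.* coeff p (j ℕ.+ suc H) ∎
  where
  open ≡-Reasoning
  j!*[1+j]≡[1+j]! : fromℤ (+ (j !)) ℚ.* fromℤ (+ suc j) ≡ fromℤ (+ (suc j !))
  j!*[1+j]≡[1+j]! = begin
    fromℤ (+ (j !)) ℚ.* fromℤ (+ suc j)  ≡⟨ fromℤ-* (+ (j !)) (+ suc j) ⟨
    fromℤ (+ (j !) ℤ.* + suc j)          ≡⟨ cong fromℤ (ℤₚ.pos-* (j !) (suc j)) ⟨
    fromℤ (+ (j ! ℕ.* suc j))            ≡⟨ cong (fromℤ ∘ +_) (ℕₚ.*-comm (j !) (suc j)) ⟩
    fromℤ (+ (suc j !))                  ∎

evalAt0≡coeff0 : ∀ p → evalAt0 p ≡ coeff p 0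
evalAt0≡coeff0 []      = refl
evalAt0≡coeff0 (c ∷ p) = refl

taylorCoeff≡coeff : ∀ H p → taylorCoeff H p ≡ coeff p H
taylorCoeff≡coeff H p = begin
  1/H! ℚ.* evalAt0 (derivN H p)             ≡⟨ cong (1/H! ℚ.*_) (evalAt0≡coeff0 (derivN H p)) ⟩
  1/H! ℚ.* coeff (derivN H p) 0             ≡⟨ cong (1/H! ℚ.*_) (ℚₚ.*-identityˡ _) ⟨
  1/H! ℚ.* (1ℚ ℚ.* coeff (derivN H p) 0)    ≡⟨ cong (1/H! ℚ.*_) (coeff-derivN H p 0) ⟩
  1/H! ℚ.* (fromℤ (+ (H !)) ℚ.* coeff p H)  ≡⟨ ℚₚ.*-assoc 1/H! (fromℤ (+ (H !))) (coeff p H) ⟨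
  (1/H! ℚ.* fromℤ (+ (H !))) ℚ.* coeff p H  ≡⟨ cong (ℚ._* coeff p H) (1/n*n≡1 (H !)) ⟩
  1ℚ ℚ.* coeff p H                          ≡⟨ ℚₚ.*-identityˡ (coeff p H) ⟩
  coeff p H                                 ∎
  where
  open ≡-Reasoning
  instance
    H!≢0 : NonZero (H !)
    H!≢0 = H ℕₚ.!≢0
  1/H! : ℚ
  1/H! = (+ 1) ℚ./ (H !)

-- Falling factorials with integer coefficients

one : ℕ → ℤ
one zero    = + 1
one (suc _) = + 0

linear : ℤ → ℤ → ℕ → ℤ
linear c s zero          = c
linear c s (suc zero)    = s
linear c s (suc (suc _)) = + 0

linearTimes : ℤ → ℤ → (ℕ → ℤ) → ℕ → ℤ
linearTimes c s f zero    = c ℤ.* f 0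
linearTimes c s f (suc h) = c ℤ.* f (suc h) ℤ.+ s ℤ.* f h

falling : ℤ → ℤ → ℕ → ℕ → ℤ
falling a s zero    = one
falling a s (suc m) = linearTimes (a ℤ.- + m) s (falling a s m)

⋆-linear : ∀ c s f → f ⋆ᶻ linear c s ≗ linearTimes c s f
⋆-linear c s f zero          = ℤₚ.*-comm (f 0) c
⋆-linear c s f (suc zero)    = swap c s (f 0) (f 1)
  where
  swap : ∀ c s x y → x ℤ.* s ℤ.+ y ℤ.* c ≡ c ℤ.* y ℤ.+ s ℤ.* x
  swap = ℤ-Solver.solve-∀
⋆-linear c s f (suc (suc h)) = begin
  f 0 ℤ.* + 0 ℤ.+ T  ≡⟨ cong (ℤ._+ T) (ℤₚ.*-zeroʳ (f 0)) ⟩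
  + 0 ℤ.+ T          ≡⟨ ℤₚ.+-identityˡ T ⟩
  T                  ≡⟨ ⋆-linear c s (f ∘ suc) (suc h) ⟩
  linearTimes c s f (suc (suc h)) ∎
  where
  open ≡-Reasoning
  T : ℤ
  T = ((f ∘ suc) ⋆ᶻ linear c s) (suc h)

fromℤ-⋆ : ∀ f g → (fromℤ ∘ f) ⋆ᵠ (fromℤ ∘ g) ≗ fromℤ ∘ (f ⋆ᶻ g)
fromℤ-⋆ f g zero    = sym (fromℤ-* (f 0) (g 0))
fromℤ-⋆ f g (suc h) = begin
  fromℤ (f 0) ℚ.* fromℤ (g (suc h)) ℚ.+ ((fromℤ ∘ f ∘ suc) ⋆ᵠ (fromℤ ∘ g)) h
    ≡⟨ cong₂ ℚ._+_ (fromℤ-* (f 0) (g (suc h))) (sym (fromℤ-⋆ (f ∘ suc) g h)) ⟨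
  fromℤ (f 0 ℤ.* g (suc h)) ℚ.+ fromℤ (((f ∘ suc) ⋆ᶻ g) h)
    ≡⟨ fromℤ-+ (f 0 ℤ.* g (suc h)) (((f ∘ suc) ⋆ᶻ g) h) ⟨
  fromℤ ((f ⋆ᶻ g) (suc h)) ∎
  where open ≡-Reasoning

coeff-linear : ∀ c s → coeff (fromℤ c ∷ fromℤ s ∷ []) ≗ fromℤ ∘ linear c s
coeff-linear c s zero          = refl
coeff-linear c s (suc zero)    = refl
coeff-linear c s (suc (suc h)) = refl

coeff-fallingPoly : ∀ a s m → coeff (fallingPoly a s m) ≗ fromℤ ∘ falling a s m
coeff-fallingPoly a s zero    zero    = refl
coeff-fallingPoly a s zero    (suc h) = refl
coeff-fallingPoly a s (suc m) h       = begin
  coeff (fallingPoly a s m ⊗ L) h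
    ≡⟨ coeff-⊗ (fallingPoly a s m) L h ⟩
  (coeff (fallingPoly a s m) ⋆ᵠ coeff L) h
    ≡⟨ ⋆ᵠ-cong (coeff-fallingPoly a s m) (coeff-linear c s) h ⟩
  ((fromℤ ∘ falling a s m) ⋆ᵠ (fromℤ ∘ linear c s)) h
    ≡⟨ fromℤ-⋆ (falling a s m) (linear c s) h ⟩
  fromℤ ((falling a s m ⋆ᶻ linear c s) h)
    ≡⟨ cong fromℤ (⋆-linear c s (falling a s m) h) ⟩
  fromℤ (falling a s (suc m) h) ∎
  where
  open ≡-Reasoning
  c : ℤ
  c = a ℤ.- + m
  L : Poly
  L = fromℤ c ∷ fromℤ s ∷ []

coeff-binomPoly : ∀ a s n →
  coeff (binomPoly a s n) ≗ λ h → ((+ 1) ℚ./ n !) {{n ℕₚ.!≢0}} ℚ.* fromℤ (falling a s n h)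
coeff-binomPoly a s n h =
  trans (coeff-scale 1/n! (fallingPoly a s n) h) (cong (1/n! ℚ.*_) (coeff-fallingPoly a s n h))
  where
  1/n! : ℚ
  1/n! = ((+ 1) ℚ./ n !) {{n ℕₚ.!≢0}}

linearTimes-cong : ∀ c s {f g} → f ≗ g → linearTimes c s f ≗ linearTimes c s g
linearTimes-cong c s f≗g zero    = cong (c ℤ.*_) (f≗g 0)
linearTimes-cong c s f≗g (suc h) = cong₂ ℤ._+_ (cong (c ℤ.*_) (f≗g (suc h))) (cong (s ℤ.*_) (f≗g h))

linearTimes-comm : ∀ c c′ s f →
  linearTimes c s (linearTimes c′ s f) ≗ linearTimes c′ s (linearTimes c s f)
linearTimes-comm c c′ s f zero          = comm₀ c c′ (f 0)
  where
  comm₀ : ∀ c c′ x → c ℤ.* (c′ ℤ.* x) ≡ c′ ℤ.* (c ℤ.* x)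
  comm₀ = ℤ-Solver.solve-∀
linearTimes-comm c c′ s f (suc zero)    = comm₁ c c′ s (f 1) (f 0)
  where
  comm₁ : ∀ c c′ s x y →
    c ℤ.* (c′ ℤ.* x ℤ.+ s ℤ.* y) ℤ.+ s ℤ.* (c′ ℤ.* y) ≡
    c′ ℤ.* (c ℤ.* x ℤ.+ s ℤ.* y) ℤ.+ s ℤ.* (c ℤ.* y)
  comm₁ = ℤ-Solver.solve-∀
linearTimes-comm c c′ s f (suc (suc h)) = comm₂ c c′ s (f (suc (suc h))) (f (suc h)) (f h)
  where
  comm₂ : ∀ c c′ s x y z →
    c ℤ.* (c′ ℤ.* x ℤ.+ s ℤ.* y) ℤ.+ s ℤ.* (c′ ℤ.* y ℤ.+ s ℤ.* z) ≡
    c′ ℤ.* (c ℤ.* x ℤ.+ s ℤ.* y) ℤ.+ s ℤ.* (c ℤ.* y ℤ.+ s ℤ.* z)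
  comm₂ = ℤ-Solver.solve-∀

linearTimes-+ : ∀ c e s f h → linearTimes (c ℤ.+ e) s f h ≡ linearTimes c s f h ℤ.+ e ℤ.* f h
linearTimes-+ c e s f zero    = ℤₚ.*-distribʳ-+ (f 0) c e
linearTimes-+ c e s f (suc h) = split c e s (f (suc h)) (f h)
  where
  split : ∀ c e s x y → (c ℤ.+ e) ℤ.* x ℤ.+ s ℤ.* y ≡ (c ℤ.* x ℤ.+ s ℤ.* y) ℤ.+ e ℤ.* x
  split = ℤ-Solver.solve-∀

falling-suc : ∀ a s m → falling (ℤ.suc a) s (suc m) ≗ linearTimes (ℤ.suc a) s (falling a s m)
falling-suc a s zero    h = cong (λ c → linearTimes c s one h) (ℤₚ.+-identityʳ (ℤ.suc a))
falling-suc a s (suc m) h = begin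
  linearTimes (ℤ.suc a ℤ.- + suc m) s (falling (ℤ.suc a) s (suc m)) h
    ≡⟨ linearTimes-cong _ s (falling-suc a s m) h ⟩
  linearTimes (ℤ.suc a ℤ.- + suc m) s (linearTimes (ℤ.suc a) s (falling a s m)) h
    ≡⟨ cong (λ c → linearTimes c s (linearTimes (ℤ.suc a) s (falling a s m)) h) (shift a (+ m)) ⟩
  linearTimes (a ℤ.- + m) s (linearTimes (ℤ.suc a) s (falling a s m)) h
    ≡⟨ linearTimes-comm (a ℤ.- + m) (ℤ.suc a) s (falling a s m) h ⟩
  linearTimes (ℤ.suc a) s (falling a s (suc m)) h ∎
  where
  open ≡-Reasoning
  shift : ∀ a x → (+ 1 ℤ.+ a) ℤ.- (+ 1 ℤ.+ x) ≡ a ℤ.- x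
  shift = ℤ-Solver.solve-∀

falling-pascal : ∀ a s m h →
  falling (ℤ.suc a) s (suc m) h ≡ falling a s (suc m) h ℤ.+ + suc m ℤ.* falling a s m h
falling-pascal a s m h = begin
  falling (ℤ.suc a) s (suc m) h
    ≡⟨ falling-suc a s m h ⟩
  linearTimes (ℤ.suc a) s (falling a s m) h
    ≡⟨ cong (λ c → linearTimes c s (falling a s m) h) (split a (+ m)) ⟩
  linearTimes ((a ℤ.- + m) ℤ.+ ℤ.suc (+ m)) s (falling a s m) h
    ≡⟨ linearTimes-+ (a ℤ.- + m) (+ suc m) s (falling a s m) h ⟩
  falling a s (suc m) h ℤ.+ + suc m ℤ.* falling a s m h ∎
  where
  open ≡-Reasoning
  split : ∀ a x → + 1 ℤ.+ a ≡ (a ℤ.- x) ℤ.+ (+ 1 ℤ.+ x)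
  split = ℤ-Solver.solve-∀

-- Vandermonde's identity

δ : ℕ → ℕ → ℕ
δ zero    zero    = 1
δ zero    (suc _) = 0
δ (suc _) zero    = 0
δ (suc m) (suc j) = δ m j

δ-refl : ∀ m → δ m m ≡ 1
δ-refl zero    = refl
δ-refl (suc m) = δ-refl m

δ-≢ : ∀ {m j} → m ≢ j → δ m j ≡ 0
δ-≢ {zero}  {zero}  m≢j = contradiction refl m≢j
δ-≢ {zero}  {suc j} m≢j = refl
δ-≢ {suc m} {zero}  m≢j = refl
δ-≢ {suc m} {suc j} m≢j = δ-≢ (m≢j ∘ cong suc)

∑δ : ∀ K m (g : ℕ → ℤ) → m < K → ∑[ j < K ] (+ δ m (toℕ j) ℤ.* g (toℕ j)) ≡ g m
∑δ (suc K) zero    g _         = begin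
  + 1 ℤ.* g 0 ℤ.+ ∑[ j < K ] (+ 0 ℤ.* g (suc (toℕ j)))
    ≡⟨ cong₂ ℤ._+_ (ℤₚ.*-identityˡ (g 0))
               (sum-cong-≗ {K} {y = λ _ → + 0} (ℤₚ.*-zeroˡ ∘ g ∘ suc ∘ toℕ)) ⟩
  g 0 ℤ.+ ∑[ j < K ] (+ 0)
    ≡⟨ cong (ℤ._+_ (g 0)) (sum-replicate-zero K) ⟩
  g 0 ℤ.+ + 0
    ≡⟨ ℤₚ.+-identityʳ (g 0) ⟩
  g 0 ∎
  where open ≡-Reasoning
∑δ (suc K) (suc m) g (s≤s m<K) = begin
  + 0 ℤ.* g 0 ℤ.+ ∑[ j < K ] (+ δ m (toℕ j) ℤ.* g (suc (toℕ j)))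
    ≡⟨ cong (ℤ._+ (∑[ j < K ] (+ δ m (toℕ j) ℤ.* g (suc (toℕ j))))) (ℤₚ.*-zeroˡ (g 0)) ⟩
  + 0 ℤ.+ ∑[ j < K ] (+ δ m (toℕ j) ℤ.* g (suc (toℕ j)))
    ≡⟨ ℤₚ.+-identityˡ _ ⟩
  ∑[ j < K ] (+ δ m (toℕ j) ℤ.* g (suc (toℕ j)))
    ≡⟨ ∑δ K m (g ∘ suc) m<K ⟩
  g (suc m) ∎
  where open ≡-Reasoning

-- (m!/j!)·C(A, m − j), generated by Pascal's rule in A.
vandermondeCoeff : ℕ → ℕ → ℕ → ℕ
vandermondeCoeff zero    m       j = δ m j
vandermondeCoeff (suc A) zero    j = δ 0 j
vandermondeCoeff (suc A) (suc m) j = vandermondeCoeff A (suc m) j ℕ.+ suc m ℕ.* vandermondeCoeff A m j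

vandermonde : ∀ K s A m → m < K → falling (+ A) s m ≗
  λ h → ∑[ j < K ] (+ vandermondeCoeff A m (toℕ j) ℤ.* falling (+ 0) s (toℕ j) h)
vandermonde K s zero    m       m<K h = sym (∑δ K m (λ j → falling (+ 0) s j h) m<K)
vandermonde K s (suc A) zero    m<K h = sym (∑δ K 0 (λ j → falling (+ 0) s j h) m<K)
vandermonde K s (suc A) (suc m) m<K h = begin
  falling (+ suc A) s (suc m) h
    ≡⟨ falling-pascal (+ A) s m h ⟩
  falling (+ A) s (suc m) h ℤ.+ + suc m ℤ.* falling (+ A) s m h
    ≡⟨ cong₂ (λ x y → x ℤ.+ + suc m ℤ.* y)
         (vandermonde K s A (suc m) m<K h) (vandermonde K s A m (ℕₚ.<⇒≤ m<K) h) ⟩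
  ∑[ j < K ] (W₁ j ℤ.* F j) ℤ.+ + suc m ℤ.* ∑[ j < K ] (W₀ j ℤ.* F j)
    ≡⟨ cong (ℤ._+_ (∑[ j < K ] (W₁ j ℤ.* F j))) (*-distribˡ-sum (+ suc m) (λ j → W₀ j ℤ.* F j)) ⟩
  ∑[ j < K ] (W₁ j ℤ.* F j) ℤ.+ ∑[ j < K ] (+ suc m ℤ.* (W₀ j ℤ.* F j))
    ≡⟨ ∑-distrib-+ (λ j → W₁ j ℤ.* F j) (λ j → + suc m ℤ.* (W₀ j ℤ.* F j)) ⟨
  ∑[ j < K ] (W₁ j ℤ.* F j ℤ.+ + suc m ℤ.* (W₀ j ℤ.* F j))
    ≡⟨ sum-cong-≗ collect ⟩
  ∑[ j < K ] (+ vandermondeCoeff (suc A) (suc m) (toℕ j) ℤ.* F j) ∎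
  where
  open ≡-Reasoning
  w₀ w₁ : Fin K → ℕ
  w₀ j = vandermondeCoeff A m (toℕ j)
  w₁ j = vandermondeCoeff A (suc m) (toℕ j)
  F W₀ W₁ : Fin K → ℤ
  F  j = falling (+ 0) s (toℕ j) h
  W₀ j = + w₀ j
  W₁ j = + w₁ j
  distrib : ∀ a b c f → a ℤ.* f ℤ.+ c ℤ.* (b ℤ.* f) ≡ (a ℤ.+ c ℤ.* b) ℤ.* f
  distrib = ℤ-Solver.solve-∀
  collect : ∀ j →
    W₁ j ℤ.* F j ℤ.+ + suc m ℤ.* (W₀ j ℤ.* F j) ≡ + (w₁ j ℕ.+ suc m ℕ.* w₀ j) ℤ.* F j
  collect j = begin
    W₁ j ℤ.* F j ℤ.+ + suc m ℤ.* (W₀ j ℤ.* F j)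
      ≡⟨ distrib (W₁ j) (W₀ j) (+ suc m) (F j) ⟩
    (W₁ j ℤ.+ + suc m ℤ.* W₀ j) ℤ.* F j
      ≡⟨ cong (λ x → (W₁ j ℤ.+ x) ℤ.* F j) (ℤₚ.pos-* (suc m) (w₀ j)) ⟨
    (W₁ j ℤ.+ + (suc m ℕ.* w₀ j)) ℤ.* F j
      ≡⟨ cong (ℤ._* F j) (ℤₚ.pos-+ (w₁ j) (suc m ℕ.* w₀ j)) ⟨
    + (w₁ j ℕ.+ suc m ℕ.* w₀ j) ℤ.* F j ∎

vandermondeCoeff-above : ∀ A {m j} → m < j → vandermondeCoeff A m j ≡ 0
vandermondeCoeff-above zero    m<j = δ-≢ (ℕₚ.<⇒≢ m<j)
vandermondeCoeff-above (suc A) {zero}  m<j = δ-≢ (ℕₚ.<⇒≢ m<j)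
vandermondeCoeff-above (suc A) {suc m} {j} m<j = begin
  vandermondeCoeff A (suc m) j ℕ.+ suc m ℕ.* vandermondeCoeff A m j
    ≡⟨ cong₂ (λ x y → x ℕ.+ suc m ℕ.* y)
         (vandermondeCoeff-above A m<j) (vandermondeCoeff-above A (ℕₚ.<-trans (ℕₚ.n<1+n m) m<j)) ⟩
  suc m ℕ.* 0
    ≡⟨ ℕₚ.*-zeroʳ (suc m) ⟩
  0 ∎
  where open ≡-Reasoning

vandermondeCoeff-diag : ∀ A m → vandermondeCoeff A m m ≡ 1
vandermondeCoeff-diag zero    m       = δ-refl m
vandermondeCoeff-diag (suc A) zero    = refl
vandermondeCoeff-diag (suc A) (suc m) =
  trans (cong₂ (λ x y → x ℕ.+ suc m ℕ.* y)
               (vandermondeCoeff-diag A (suc m)) (vandermondeCoeff-above A (ℕₚ.n<1+n m)))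
        (cong suc (ℕₚ.*-zeroʳ (suc m)))

vandermondeCoeff-*-! : ∀ A {m j} → j ≤ m → vandermondeCoeff A m j ℕ.* j ! ≡ (A C (m ∸ j)) ℕ.* m !
vandermondeCoeff-*-! A {m} {j} j≤m with ℕₚ.m≤n⇒m<n∨m≡n j≤m
... | inj₂ refl =
  trans (cong (ℕ._* m !) (vandermondeCoeff-diag A m)) (cong (λ k → (A C k) ℕ.* m !) (sym (ℕₚ.n∸n≡0 m)))
... | inj₁ j<m  = below A j<m
  where
  below : ∀ A {m j} → j < m → vandermondeCoeff A m j ℕ.* j ! ≡ (A C (m ∸ j)) ℕ.* m !
  below zero    {m} {j} j<m = trans (cong (ℕ._* j !) (δ-≢ (ℕₚ.<⇒≢ j<m ∘ sym)))
    (sym (cong (ℕ._* m !) (k>n⇒nCk≡0 (ℕₚ.m<n⇒0<n∸m j<m))))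
  below (suc A) {suc m} {j} (s≤s j≤m) = begin
    (W₁ ℕ.+ suc m ℕ.* W₀) ℕ.* j !
      ≡⟨ distrib W₁ W₀ m (j !) ⟩
    W₁ ℕ.* j ! ℕ.+ suc m ℕ.* (W₀ ℕ.* j !)
      ≡⟨ cong₂ (λ x y → x ℕ.+ suc m ℕ.* y)
               (vandermondeCoeff-*-! A (ℕₚ.m≤n⇒m≤1+n j≤m)) (vandermondeCoeff-*-! A j≤m) ⟩
    (A C (suc m ∸ j)) ℕ.* suc m ! ℕ.+ suc m ℕ.* ((A C (m ∸ j)) ℕ.* m !)
      ≡⟨ cong (λ k → (A C k) ℕ.* suc m ! ℕ.+ suc m ℕ.* ((A C (m ∸ j)) ℕ.* m !))
              (ℕₚ.+-∸-assoc 1 j≤m) ⟩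
    (A C suc (m ∸ j)) ℕ.* suc m ! ℕ.+ suc m ℕ.* ((A C (m ∸ j)) ℕ.* m !)
      ≡⟨ collect (A C suc (m ∸ j)) (A C (m ∸ j)) m (m !) ⟩
    ((A C (m ∸ j)) ℕ.+ (A C suc (m ∸ j))) ℕ.* suc m !
      ≡⟨ cong (ℕ._* suc m !) (nCk+nC[k+1]≡[n+1]C[k+1] A (m ∸ j)) ⟩
    (suc A C suc (m ∸ j)) ℕ.* suc m !
      ≡⟨ cong (λ k → (suc A C k) ℕ.* suc m !) (ℕₚ.+-∸-assoc 1 j≤m) ⟨
    (suc A C (suc m ∸ j)) ℕ.* suc m ! ∎
    where
    open ≡-Reasoning
    W₀ W₁ : ℕ
    W₀ = vandermondeCoeff A m j
    W₁ = vandermondeCoeff A (suc m) j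
    distrib : ∀ a b m f → (a ℕ.+ suc m ℕ.* b) ℕ.* f ≡ a ℕ.* f ℕ.+ suc m ℕ.* (b ℕ.* f)
    distrib = ℕ-Solver.solve-∀
    collect : ∀ x y m f →
      x ℕ.* (f ℕ.+ m ℕ.* f) ℕ.+ suc m ℕ.* (y ℕ.* f) ≡ (y ℕ.+ x) ℕ.* (f ℕ.+ m ℕ.* f)
    collect = ℕ-Solver.solve-∀

-- Binomial coefficients and residues modulo a prime

C-absorb : ∀ a k → suc k ℕ.* (suc a C suc k) ≡ suc a ℕ.* (a C k)
C-absorb a       zero    =
  trans (ℕₚ.*-identityˡ (suc a C 1)) (trans (nC1≡n (suc a)) (sym (ℕₚ.*-identityʳ (suc a))))
C-absorb zero    (suc k) = ℕₚ.*-zeroʳ (suc (suc k))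
C-absorb (suc a) (suc k) = begin
  suc (suc k) ℕ.* (suc (suc a) C suc (suc k))
    ≡⟨ cong (suc (suc k) ℕ.*_) (nCk+nC[k+1]≡[n+1]C[k+1] (suc a) (suc k)) ⟨
  suc (suc k) ℕ.* (X ℕ.+ Y)
    ≡⟨ spread k X Y ⟩
  X ℕ.+ (suc k ℕ.* X ℕ.+ suc (suc k) ℕ.* Y)
    ≡⟨ cong₂ (λ u v → X ℕ.+ (u ℕ.+ v)) (C-absorb a k) (C-absorb a (suc k)) ⟩
  X ℕ.+ (suc a ℕ.* (a C k) ℕ.+ suc a ℕ.* (a C suc k))
    ≡⟨ cong (X ℕ.+_) (ℕₚ.*-distribˡ-+ (suc a) (a C k) (a C suc k)) ⟨
  X ℕ.+ suc a ℕ.* ((a C k) ℕ.+ (a C suc k))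
    ≡⟨ cong (λ u → X ℕ.+ suc a ℕ.* u) (nCk+nC[k+1]≡[n+1]C[k+1] a k) ⟩
  suc (suc a) ℕ.* X ∎
  where
  open ≡-Reasoning
  X Y : ℕ
  X = suc a C suc k
  Y = suc a C suc (suc k)
  spread : ∀ k x y → suc (suc k) ℕ.* (x ℕ.+ y) ≡ x ℕ.+ (suc k ℕ.* x ℕ.+ suc (suc k) ℕ.* y)
  spread = ℕ-Solver.solve-∀

module _ {p} (p-prime : Prime p) where

  private instance
    p≢0 : NonZero p
    p≢0 = prime⇒nonZero p-prime

  p∤[1+t]+q*p : ∀ q {t} → suc t < p → ¬ p ∣ suc t ℕ.+ q ℕ.* p
  p∤[1+t]+q*p q {t} t<p p∣ =
    ℕₚ.<⇒≱ t<p (∣⇒≤ (∣m+n∣m⇒∣n (subst (p ∣_) (ℕₚ.+-comm (suc t) (q ℕ.* p)) p∣) (n∣m*n q)))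

  p∣C-suc : ∀ {a k} → ¬ p ∣ suc k → p ∣ suc a ℕ.* (a C k) → p ∣ suc a C suc k
  p∣C-suc {a} {k} p∤1+k p∣
    with euclidsLemma (suc k) (suc a C suc k) p-prime (subst (p ∣_) (sym (C-absorb a k)) p∣)
  ... | inj₁ p∣1+k = contradiction p∣1+k p∤1+k
  ... | inj₂ p∣C   = p∣C

  p∣C-of-multiple : ∀ {A k} → p ∣ A → ¬ p ∣ suc k → p ∣ A C suc k
  p∣C-of-multiple {zero}  _   _   = p ∣0
  p∣C-of-multiple {suc a} {k} p∣A p∤1+k = p∣C-suc p∤1+k (∣m⇒∣m*n (a C k) p∣A)

  p∣C-digits : ∀ q q′ {r t} → r < t → t < p → p ∣ (r ℕ.+ q ℕ.* p) C (t ℕ.+ q′ ℕ.* p)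
  p∣C-digits q q′ {zero}  {suc t} _          t<p = p∣C-of-multiple (n∣m*n q) (p∤[1+t]+q*p q′ t<p)
  p∣C-digits q q′ {suc r} {suc t} (s≤s r<t) t<p = p∣C-suc (p∤[1+t]+q*p q′ t<p)
    (∣n⇒∣m*n (suc (r ℕ.+ q ℕ.* p)) (p∣C-digits q q′ r<t (ℕₚ.<-trans (ℕₚ.n<1+n t) t<p)))

  -- Subtracting B from A in base p borrows in the last digit (Kummer).
  p∣C : ∀ {A B} → A % p < B % p → p ∣ A C B
  p∣C {A} {B} lt = subst₂ (λ x y → p ∣ x C y) (sym (m≡m%n+[m/n]*n A p)) (sym (m≡m%n+[m/n]*n B p))
    (p∣C-digits (A / p) (B / p) lt (m%n<n B p))

m+kp≡n+lp∧m<n⇒m+p≤n : ∀ p {m n} k l → m ℕ.+ k ℕ.* p ≡ n ℕ.+ l ℕ.* p → m < n → m ℕ.+ p ≤ n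
m+kp≡n+lp∧m<n⇒m+p≤n p {m} {n} k l eq m<n with k ℕₚ.≤? l
... | yes k≤l with ℕₚ.m≤n⇒∃[o]m+o≡n k≤l
...   | o , refl = contradiction m<n (ℕₚ.≤⇒≯ (subst (n ≤_) (sym m≡n+op) (ℕₚ.m≤m+n n (o ℕ.* p))))
  where
  regroup : ∀ n k o p → n ℕ.+ (k ℕ.+ o) ℕ.* p ≡ (n ℕ.+ o ℕ.* p) ℕ.+ k ℕ.* p
  regroup = ℕ-Solver.solve-∀
  m≡n+op : m ≡ n ℕ.+ o ℕ.* p
  m≡n+op = ℕₚ.+-cancelʳ-≡ (k ℕ.* p) m (n ℕ.+ o ℕ.* p) (trans eq (regroup n k o p))
m+kp≡n+lp∧m<n⇒m+p≤n p {m} {n} k l eq m<n | no k≰l with ℕₚ.m≤n⇒∃[o]m+o≡n (ℕₚ.≰⇒> k≰l)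
... | o , refl = subst (m ℕ.+ p ≤_) m+p+op≡n (ℕₚ.m≤m+n (m ℕ.+ p) (o ℕ.* p))
  where
  regroup : ∀ m l o p → m ℕ.+ (suc l ℕ.+ o) ℕ.* p ≡ (m ℕ.+ p ℕ.+ o ℕ.* p) ℕ.+ l ℕ.* p
  regroup = ℕ-Solver.solve-∀
  m+p+op≡n : m ℕ.+ p ℕ.+ o ℕ.* p ≡ n
  m+p+op≡n = ℕₚ.+-cancelʳ-≡ (l ℕ.* p) _ n (trans (sym (regroup m l o p)) eq)

module _ {p} .{{_ : NonZero p}} where

  residues-of-n+i-and-2n-i : ∀ {n i} → i ≤ n →
    ((n ℕ.+ i) % p ℕ.+ (2 ℕ.* n ∸ i) % p) ℕ.+ ((n ℕ.+ i) / p ℕ.+ (2 ℕ.* n ∸ i) / p) ℕ.* p ≡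
    3 ℕ.* (n % p) ℕ.+ (3 ℕ.* (n / p)) ℕ.* p
  residues-of-n+i-and-2n-i {n} {i} i≤n = begin
    (a ℕ.+ b) ℕ.+ (K ℕ.+ L) ℕ.* p             ≡⟨ regroup a b K L p ⟩
    (a ℕ.+ K ℕ.* p) ℕ.+ (b ℕ.+ L ℕ.* p)       ≡⟨ cong₂ ℕ._+_ (m≡m%n+[m/n]*n (n ℕ.+ i) p)
                                                              (m≡m%n+[m/n]*n (2 ℕ.* n ∸ i) p) ⟨
    (n ℕ.+ i) ℕ.+ (2 ℕ.* n ∸ i)                ≡⟨ reassoc n i (2 ℕ.* n ∸ i) ⟩
    n ℕ.+ ((2 ℕ.* n ∸ i) ℕ.+ i)                ≡⟨ cong (n ℕ.+_) (ℕₚ.m∸n+n≡m i≤2n) ⟩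
    n ℕ.+ 2 ℕ.* n                              ≡⟨ cong (λ m → m ℕ.+ 2 ℕ.* m) (m≡m%n+[m/n]*n n p) ⟩
    (y ℕ.+ N ℕ.* p) ℕ.+ 2 ℕ.* (y ℕ.+ N ℕ.* p)  ≡⟨ triple y N p ⟩
    3 ℕ.* y ℕ.+ (3 ℕ.* N) ℕ.* p                ∎
    where
    open ≡-Reasoning
    y a b K L N : ℕ
    y = n % p
    a = (n ℕ.+ i) % p
    b = (2 ℕ.* n ∸ i) % p
    K = (n ℕ.+ i) / p
    L = (2 ℕ.* n ∸ i) / p
    N = n / p
    i≤2n : i ≤ 2 ℕ.* n
    i≤2n = ℕₚ.≤-trans i≤n (ℕₚ.m≤m+n n (n ℕ.+ 0))
    regroup : ∀ a b K L p → (a ℕ.+ b) ℕ.+ (K ℕ.+ L) ℕ.* p ≡ (a ℕ.+ K ℕ.* p) ℕ.+ (b ℕ.+ L ℕ.* p)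
    regroup = ℕ-Solver.solve-∀
    reassoc : ∀ n i x → (n ℕ.+ i) ℕ.+ x ≡ n ℕ.+ (x ℕ.+ i)
    reassoc = ℕ-Solver.solve-∀
    triple : ∀ y N p → (y ℕ.+ N ℕ.* p) ℕ.+ 2 ℕ.* (y ℕ.+ N ℕ.* p) ≡ 3 ℕ.* y ℕ.+ (3 ℕ.* N) ℕ.* p
    triple = ℕ-Solver.solve-∀

  -- With y = n mod p, the residues a, b satisfy a + b ≡ 3y (mod p) and a + b < 2p ≤ 3y,
  -- so a + b ≤ 3y − p < 2y.
  residue-drops : ∀ {n i} → i ≤ n → 2 ℕ.* p ≤ 3 ℕ.* (n % p) →
                  (n ℕ.+ i) % p < n % p ⊎ (2 ℕ.* n ∸ i) % p < n % p
  residue-drops {n} {i} i≤n 2p≤3y with (n ℕ.+ i) % p ℕₚ.<? n % p | (2 ℕ.* n ∸ i) % p ℕₚ.<? n % p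
  ... | yes a<y | _       = inj₁ a<y
  ... | no _    | yes b<y = inj₂ b<y
  ... | no a≮y  | no b≮y  = contradiction
    (m+kp≡n+lp∧m<n⇒m+p≤n p ((n ℕ.+ i) / p ℕ.+ (2 ℕ.* n ∸ i) / p) (3 ℕ.* (n / p))
      (residues-of-n+i-and-2n-i i≤n) a+b<3y)
    (ℕₚ.<⇒≱ 3y<a+b+p)
    where
    y a b : ℕ
    y = n % p
    a = (n ℕ.+ i) % p
    b = (2 ℕ.* n ∸ i) % p
    thrice : ∀ y → y ℕ.+ y ℕ.+ y ≡ 3 ℕ.* y
    thrice = ℕ-Solver.solve-∀
    a+b<3y : a ℕ.+ b < 3 ℕ.* y
    a+b<3y = ℕₚ.<-≤-trans (ℕₚ.+-mono-< (m%n<n (n ℕ.+ i) p) (m%n<n (2 ℕ.* n ∸ i) p))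
               (subst (_≤ 3 ℕ.* y) (cong (p ℕ.+_) (ℕₚ.+-identityʳ p)) 2p≤3y)
    3y<a+b+p : 3 ℕ.* y < a ℕ.+ b ℕ.+ p
    3y<a+b+p = subst (_< a ℕ.+ b ℕ.+ p) (thrice y)
                 (ℕₚ.+-mono-≤-< (ℕₚ.+-mono-≤ (ℕₚ.≮⇒≥ a≮y) (ℕₚ.≮⇒≥ b≮y)) (m%n<n n p))

∈⇒∣foldr-lcm : ∀ {x b xs} → x ∈ xs → x ∣ foldr lcm b xs
∈⇒∣foldr-lcm {xs = y ∷ ys} (here refl) = m∣lcm[m,n] y _
∈⇒∣foldr-lcm {xs = y ∷ ys} (there x∈ys) = ∣-trans (∈⇒∣foldr-lcm x∈ys) (n∣lcm[m,n] y _)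

∣d : ∀ {n k} .{{_ : NonZero k}} → k ≤ n → k ∣ d n
∣d {n} {suc k} k<n = ∈⇒∣foldr-lcm (∈-map⁺ suc (∈-upTo⁺ k<n))

prime∣prime⇒≡ : ∀ {p q} → Prime p → Prime q → p ∣ q → p ≡ q
prime∣prime⇒≡ p-prime q-prime p∣q with prime⇒irreducible q-prime p∣q
... | inj₁ refl = contradiction p-prime ¬prime[1]
... | inj₂ p≡q  = p≡q

prime*∣ : ∀ {p m n} → Prime p → ¬ p ∣ m → p ∣ n → m ∣ n → p ℕ.* m ∣ n
prime*∣ {p} {m} p-prime p∤m p∣n (divides c refl) with euclidsLemma c m p-prime p∣n
... | inj₁ p∣c = *-monoˡ-∣ m p∣c
... | inj₂ p∣m = contradiction p∣m p∤m

module _ (f : ℕ → ℕ) where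

  PrimeOrOne : ℕ → Set
  PrimeOrOne x = f x ≡ 1 ⊎ (f x ≡ x × Prime x)

  prime∤∏ : ∀ {p xs} → Prime p → All (p ≢_) xs → (∀ {x} → x ∈ xs → PrimeOrOne x) →
            ¬ p ∣ product (map f xs)
  prime∤∏ {p} {[]}     p-prime []          _     p∣1 = ¬prime[1] (subst Prime (∣1⇒≡1 p∣1) p-prime)
  prime∤∏ {p} {x ∷ xs} p-prime (p≢x ∷ p∉) cases p∣
    with euclidsLemma (f x) (product (map f xs)) p-prime p∣
  ... | inj₂ p∣∏ = prime∤∏ p-prime p∉ (cases ∘ there) p∣∏
  ... | inj₁ p∣fx with cases (here refl)
  ...   | inj₁ fx≡1            = ¬prime[1] (subst Prime (∣1⇒≡1 (subst (p ∣_) fx≡1 p∣fx)) p-prime)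
  ...   | inj₂ (fx≡x , x-prime) = p≢x (prime∣prime⇒≡ p-prime x-prime (subst (p ∣_) fx≡x p∣fx))

  ∏-∣ : ∀ {Y xs} → Unique xs → (∀ {x} → x ∈ xs → PrimeOrOne x × f x ∣ Y) →
        product (map f xs) ∣ Y
  ∏-∣ {Y} {[]}     []          _     = 1∣ Y
  ∏-∣ {Y} {x ∷ xs} (x∉ ∷ uniq) cases with cases (here refl) | ∏-∣ uniq (cases ∘ there)
  ... | inj₁ fx≡1 , _ | ∏∣Y =
    subst (λ z → z ℕ.* product (map f xs) ∣ Y) (sym fx≡1) (subst (_∣ Y) (sym (ℕₚ.*-identityˡ _)) ∏∣Y)
  ... | inj₂ (fx≡x , x-prime) , fx∣Y | ∏∣Y =
    subst (λ z → z ℕ.* product (map f xs) ∣ Y) (sym fx≡x)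
      (prime*∣ x-prime (prime∤∏ x-prime x∉ (proj₁ ∘ cases ∘ there)) (subst (_∣ Y) fx≡x fx∣Y) ∏∣Y)

record Φ̃-Prime (n p : ℕ) : Set where
  field
    isPrime  : Prime p
    p<n      : p < n
    residue≥ : 2 ℕ.* p ≤ 3 ℕ.* (_%_ n p {{prime⇒nonZero isPrime}})

phiFactor-cases : ∀ n q → q < n → phiFactor n q ≡ 1 ⊎ (phiFactor n q ≡ q × Φ̃-Prime n q)
phiFactor-cases n zero    _   = inj₁ refl
phiFactor-cases n (suc q) q<n with prime? (suc q) | 2 ℕ.* suc q ℕₚ.≤? 3 ℕ.* (n % suc q)
... | yes q-prime | yes large = inj₂ (refl , record { isPrime = q-prime ; p<n = q<n ; residue≥ = large })
... | yes _       | no _      = inj₁ refl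
... | no _        | _         = inj₁ refl

Φ̃-∣ : ∀ n {Y} → (∀ {p} → Φ̃-Prime n p → p ∣ Y) → tildePhi n ∣ Y
Φ̃-∣ n {Y} p∣Y = ∏-∣ (phiFactor n) (upTo⁺ n) cases
  where
  cases : ∀ {q} → q ∈ upTo n → PrimeOrOne (phiFactor n) q × phiFactor n q ∣ Y
  cases {q} q∈ with phiFactor-cases n q (∈-upTo⁻ q∈)
  ... | inj₁ φ≡1       = inj₁ φ≡1 , subst (_∣ Y) (sym φ≡1) (1∣ Y)
  ... | inj₂ (φ≡q , P) = inj₂ (φ≡q , Φ̃-Prime.isPrime P) , subst (_∣ Y) (sym φ≡q) (p∣Y P)

-- Denominators of the Taylor coefficients

*-pres-∣ᶻ : ∀ {a b x y} → a ∣ᶻ x → b ∣ᶻ y → a ℤ.* b ∣ᶻ x ℤ.* y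
*-pres-∣ᶻ {a} {b} (ℤᵈ.divides q refl) (ℤᵈ.divides r refl) = ℤᵈ.divides (q ℤ.* r) (interchange q a r b)
  where
  interchange : ∀ q a r b → (q ℤ.* a) ℤ.* (r ℤ.* b) ≡ (q ℤ.* r) ℤ.* (a ℤ.* b)
  interchange = ℤ-Solver.solve-∀

module Scaled (D : ℕ) where

  infix 4 _∣ₛ_

  _∣ₛ_ : ℕ → (ℕ → ℤ) → Set
  M ∣ₛ f = ∀ h → + M ∣ᶻ (+ D) ℤ.^ h ℤ.* f h

  ∣ₛ-cong : ∀ {M f g} → f ≗ g → M ∣ₛ f → M ∣ₛ g
  ∣ₛ-cong f≗g M∣f h = subst (λ x → _ ∣ᶻ (+ D) ℤ.^ h ℤ.* x) (f≗g h) (M∣f h)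

  ∣ₛ-weaken : ∀ {M N f} → N ∣ M → M ∣ₛ f → N ∣ₛ f
  ∣ₛ-weaken N∣M M∣f h = ℤᵈ.∣-trans (∣ᵤ⇒∣ N∣M) (M∣f h)

  ∣ₛ-scale : ∀ {M f} c → M ∣ₛ f → c ℕ.* M ∣ₛ λ h → + c ℤ.* f h
  ∣ₛ-scale {M} {f} c M∣f h = subst₂ _∣ᶻ_ (sym (ℤₚ.pos-* c M)) (swap (+ c) ((+ D) ℤ.^ h) (f h))
    (*-pres-∣ᶻ (ℤᵈ.∣-refl {+ c}) (M∣f h))
    where
    swap : ∀ c x y → c ℤ.* (x ℤ.* y) ≡ x ℤ.* (c ℤ.* y)
    swap = ℤ-Solver.solve-∀

  ∣ₛ-sum : ∀ {K M} (f : Fin K → ℕ → ℤ) → (∀ j → M ∣ₛ f j) →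
           M ∣ₛ λ h → ∑[ j < K ] f j h
  ∣ₛ-sum {zero}  f M∣f h = subst (_ ∣ᶻ_) (sym (ℤₚ.*-zeroʳ ((+ D) ℤ.^ h))) (∣ᵤ⇒∣ (_ ∣0))
  ∣ₛ-sum {suc K} f M∣f h = subst (_ ∣ᶻ_) (sym (ℤₚ.*-distribˡ-+ ((+ D) ℤ.^ h) (f Fin.zero h) _))
    (∣m∣n⇒∣m+n (M∣f Fin.zero h) (∣ₛ-sum (f ∘ Fin.suc) (M∣f ∘ Fin.suc) h))

  ∣ₛ-linearTimes : ∀ {M f g c} s → M ∣ₛ f → + g ∣ᶻ c → g ∣ D →
                   M ℕ.* g ∣ₛ linearTimes c s f
  ∣ₛ-linearTimes {M} {f} {g} {c} s M∣f g∣c g∣D zero =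
    subst₂ _∣ᶻ_ (sym (ℤₚ.pos-* M g)) (swap c (f 0)) (*-pres-∣ᶻ (M∣f 0) g∣c)
    where
    swap : ∀ c x → (+ 1 ℤ.* x) ℤ.* c ≡ + 1 ℤ.* (c ℤ.* x)
    swap = ℤ-Solver.solve-∀
  ∣ₛ-linearTimes {M} {f} {g} {c} s M∣f g∣c g∣D (suc h) =
    subst₂ _∣ᶻ_ (sym (ℤₚ.pos-* M g)) (regroup (+ D) ((+ D) ℤ.^ h) c s (f (suc h)) (f h))
      (∣m∣n⇒∣m+n (*-pres-∣ᶻ (M∣f (suc h)) g∣c) (ℤᵈ.∣n⇒∣m*n s (*-pres-∣ᶻ (M∣f h) (∣ᵤ⇒∣ g∣D))))
    where
    regroup : ∀ X Y c s x y →
      ((X ℤ.* Y) ℤ.* x) ℤ.* c ℤ.+ s ℤ.* ((Y ℤ.* y) ℤ.* X) ≡ (X ℤ.* Y) ℤ.* (c ℤ.* x ℤ.+ s ℤ.* y)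
    regroup = ℤ-Solver.solve-∀

  -- The multiplier c absorbs the powers of D that the shifted sequence f ∘ suc is missing.
  ∣ₛ-⋆-scaled : ∀ {M N f g} c → (∀ h → + M ∣ᶻ c ℤ.* ((+ D) ℤ.^ h ℤ.* f h)) → N ∣ₛ g →
                ∀ h → + M ℤ.* + N ∣ᶻ c ℤ.* ((+ D) ℤ.^ h ℤ.* (f ⋆ᶻ g) h)
  ∣ₛ-⋆-scaled {f = f} {g} c M∣f N∣g zero =
    subst (_ ∣ᶻ_) (regroup c (f 0) (g 0)) (*-pres-∣ᶻ (M∣f 0) (N∣g 0))
    where
    regroup : ∀ c x y → (c ℤ.* (+ 1 ℤ.* x)) ℤ.* (+ 1 ℤ.* y) ≡ c ℤ.* (+ 1 ℤ.* (x ℤ.* y))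
    regroup = ℤ-Solver.solve-∀
  ∣ₛ-⋆-scaled {M} {f = f} {g} c M∣f N∣g (suc h) =
    subst (_ ∣ᶻ_) (regroup c (+ D) ((+ D) ℤ.^ h) (f 0) (g (suc h)) (((f ∘ suc) ⋆ᶻ g) h))
      (∣m∣n⇒∣m+n (*-pres-∣ᶻ (M∣f 0) (N∣g (suc h))) (∣ₛ-⋆-scaled (c ℤ.* + D) M∣f∘suc N∣g h))
    where
    shift : ∀ c X Y x → c ℤ.* ((X ℤ.* Y) ℤ.* x) ≡ (c ℤ.* X) ℤ.* (Y ℤ.* x)
    shift = ℤ-Solver.solve-∀
    M∣f∘suc : ∀ h → + M ∣ᶻ (c ℤ.* + D) ℤ.* ((+ D) ℤ.^ h ℤ.* f (suc h))
    M∣f∘suc h = subst (_ ∣ᶻ_) (shift c (+ D) ((+ D) ℤ.^ h) (f (suc h))) (M∣f (suc h))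
    regroup : ∀ c X Y x y z →
      (c ℤ.* (+ 1 ℤ.* x)) ℤ.* ((X ℤ.* Y) ℤ.* y) ℤ.+ (c ℤ.* X) ℤ.* (Y ℤ.* z) ≡
      c ℤ.* ((X ℤ.* Y) ℤ.* (x ℤ.* y ℤ.+ z))
    regroup = ℤ-Solver.solve-∀

  ∣ₛ-⋆ : ∀ {M N f g} → M ∣ₛ f → N ∣ₛ g → M ℕ.* N ∣ₛ f ⋆ᶻ g
  ∣ₛ-⋆ {M} {N} {f} {g} M∣f N∣g h = subst₂ _∣ᶻ_ (sym (ℤₚ.pos-* M N)) (ℤₚ.*-identityˡ _)
    (∣ₛ-⋆-scaled (+ 1) (λ h → subst (_ ∣ᶻ_) (sym (ℤₚ.*-identityˡ _)) (M∣f h)) N∣g h)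

module FallingDivisibility (n D : ℕ) (∣D : ∀ {k} .{{_ : NonZero k}} → k ≤ n → k ∣ D) where

  open Scaled D

  fallingAt0Divisor : ℕ → ℕ
  fallingAt0Divisor zero    = 1
  fallingAt0Divisor (suc j) = D ℕ.* j !

  ∣ₛ-fallingAt0 : ∀ s {j} → j ≤ n → fallingAt0Divisor j ∣ₛ falling (+ 0) s j
  ∣ₛ-fallingAt0 s {zero}        _   h = ∣ᵤ⇒∣ (1∣ _)
  ∣ₛ-fallingAt0 s {suc zero}    _     = subst (_∣ₛ falling (+ 0) s 1) (ℕₚ.*-comm 1 D)
    (∣ₛ-linearTimes s (λ h → ∣ᵤ⇒∣ (1∣ _)) (∣ᵤ⇒∣ (D ∣0)) ∣-refl)
  ∣ₛ-fallingAt0 s {suc (suc j)} j<n = subst (_∣ₛ falling (+ 0) s (suc (suc j))) (reassoc D (j !) j)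
    (∣ₛ-linearTimes s (∣ₛ-fallingAt0 s j≤n) (∣ᵤ⇒∣ ∣-refl) (∣D j≤n))
    where
    j≤n : suc j ≤ n
    j≤n = ℕₚ.<⇒≤ j<n
    reassoc : ∀ D f j → D ℕ.* f ℕ.* suc j ≡ D ℕ.* (f ℕ.+ j ℕ.* f)
    reassoc = ℕ-Solver.solve-∀

  ∣ₛ-falling : ∀ {M} A s → (∀ {j} → j ≤ n → M ∣ vandermondeCoeff A n j ℕ.* fallingAt0Divisor j) →
               M ∣ₛ falling (+ A) s n
  ∣ₛ-falling A s M∣ = ∣ₛ-cong (sym ∘ vandermonde (suc n) s A n (ℕₚ.n<1+n n))
    (∣ₛ-sum (λ j h → + W j ℤ.* falling (+ 0) s (toℕ j) h)
      λ j → ∣ₛ-weaken (M∣ (toℕ≤pred[n] j)) (∣ₛ-scale (W j) (∣ₛ-fallingAt0 s (toℕ≤pred[n] j))))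
    where
    W : Fin (suc n) → ℕ
    W j = vandermondeCoeff A n (toℕ j)

  weight-suc : ∀ A {j q} → suc j ≤ n → D ≡ q ℕ.* suc j →
    vandermondeCoeff A n (suc j) ℕ.* fallingAt0Divisor (suc j) ≡ q ℕ.* ((A C (n ∸ suc j)) ℕ.* n !)
  weight-suc A {j} {q} j<n refl = begin
    W ℕ.* (q ℕ.* suc j ℕ.* j !)   ≡⟨ regroup W q j (j !) ⟩
    q ℕ.* (W ℕ.* suc j !)         ≡⟨ cong (q ℕ.*_) (vandermondeCoeff-*-! A j<n) ⟩
    q ℕ.* ((A C (n ∸ suc j)) ℕ.* n !) ∎
    where
    open ≡-Reasoning
    W : ℕ
    W = vandermondeCoeff A n (suc j)
    regroup : ∀ w q j f → w ℕ.* (q ℕ.* suc j ℕ.* f) ≡ q ℕ.* (w ℕ.* (f ℕ.+ j ℕ.* f))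
    regroup = ℕ-Solver.solve-∀

  n!∣weight : ∀ A {j} → j ≤ n → n ! ∣ vandermondeCoeff A n j ℕ.* fallingAt0Divisor j
  n!∣weight A {zero}  _   = divides (A C n) (vandermondeCoeff-*-! A z≤n)
  n!∣weight A {suc j} j<n with ∣D j<n
  ... | divides q D≡q[1+j] = divides (q ℕ.* (A C (n ∸ suc j)))
    (trans (weight-suc A {q = q} j<n D≡q[1+j]) (sym (ℕₚ.*-assoc q (A C (n ∸ suc j)) (n !))))

  module _ {p} (p-prime : Prime p) (p≤n : p ≤ n) where

    private instance
      p≢0 : NonZero p
      p≢0 = prime⇒nonZero p-prime

    -- p ∤ j forces p ∣ D/j, while p ∣ j brings in the factor p ∣ C(A, n − j).
    p*n!∣weight : ∀ A {j} → j ≤ n → (p ∣ j → p ∣ A C (n ∸ j)) →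
                  p ℕ.* n ! ∣ vandermondeCoeff A n j ℕ.* fallingAt0Divisor j
    p*n!∣weight A {zero} _ p∣C = subst (p ℕ.* n ! ∣_) (sym (vandermondeCoeff-*-! A z≤n))
      (*-monoˡ-∣ (n !) (p∣C (p ∣0)))
    p*n!∣weight A {suc j} j<n p∣C with ∣D j<n
    ... | divides q D≡q[1+j] = subst (p ℕ.* n ! ∣_) (sym (weight-suc A {q = q} j<n D≡q[1+j])) p*n!∣q*C*n!
      where
      p*n!∣q*C*n! : p ℕ.* n ! ∣ q ℕ.* ((A C (n ∸ suc j)) ℕ.* n !)
      p*n!∣q*C*n! with euclidsLemma q (suc j) p-prime (subst (p ∣_) D≡q[1+j] (∣D p≤n))
      ... | inj₁ p∣q   = *-pres-∣ p∣q (n∣m*n (A C (n ∸ suc j)))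
      ... | inj₂ p∣1+j = ∣n⇒∣m*n q (*-monoˡ-∣ (n !) (p∣C p∣1+j))

    p∣C[n∸j] : ∀ {A j} → A % p < n % p → j ≤ n → p ∣ j → p ∣ A C (n ∸ j)
    p∣C[n∸j] {A} A%p<n%p j≤n (divides c refl) =
      p∣C p-prime (subst (A % p <_) (sym (m*n≤o⇒[o∸m*n]%n≡o%n c j≤n)) A%p<n%p)

    p*n!∣ₛfalling : ∀ A s → A % p < n % p → p ℕ.* n ! ∣ₛ falling (+ A) s n
    p*n!∣ₛfalling A s A%p<n%p = ∣ₛ-falling A s λ j≤n → p*n!∣weight A j≤n (p∣C[n∸j] A%p<n%p j≤n)

  n!∣ₛfalling : ∀ A s → n ! ∣ₛ falling (+ A) s n
  n!∣ₛfalling A s = ∣ₛ-falling A s (n!∣weight A)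

Φ̃*M∣ : ∀ n {M x} .{{_ : NonZero M}} → + M ∣ᶻ x → (∀ {p} → Φ̃-Prime n p → + (p ℕ.* M) ∣ᶻ x) →
       + (tildePhi n ℕ.* M) ∣ᶻ x
Φ̃*M∣ n {M} (ℤᵈ.divides y refl) p*M∣x = subst (_∣ᶻ y ℤ.* + M) (sym (ℤₚ.pos-* (tildePhi n) M))
  (*-pres-∣ᶻ (∣ᵤ⇒∣ {+ tildePhi n} {y} (Φ̃-∣ n p∣y)) (ℤᵈ.∣-refl {+ M}))
  where
  p∣y : ∀ {p} → Φ̃-Prime n p → p ∣ ℤ.∣ y ∣
  p∣y {p} P = *-cancelʳ-∣ M (subst (p ℕ.* M ∣_) (ℤₚ.abs-* y (+ M)) (ℤᵈ.∣⇒∣ᵤ (p*M∣x P)))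

thePolyℤ : ℕ → ℕ → ℕ → ℤ
thePolyℤ n i = falling (+ (n ℕ.+ i)) (+ 1) n ⋆ᶻ falling (+ (2 ℕ.* n ∸ i)) (ℤ.- (+ 1)) n

module _ (n : ℕ) where

  open Scaled (d n)
  open FallingDivisibility n (d n) ∣d

  n!²∣ₛthePolyℤ : ∀ i → n ! ℕ.* n ! ∣ₛ thePolyℤ n i
  n!²∣ₛthePolyℤ i = ∣ₛ-⋆ (n!∣ₛfalling (n ℕ.+ i) (+ 1)) (n!∣ₛfalling (2 ℕ.* n ∸ i) (ℤ.- (+ 1)))

  p*n!²∣ₛthePolyℤ : ∀ {i p} → i ≤ n → Φ̃-Prime n p → p ℕ.* (n ! ℕ.* n !) ∣ₛ thePolyℤ n i
  p*n!²∣ₛthePolyℤ {i} {p} i≤n record { isPrime = p-prime ; p<n = p<n ; residue≥ = large }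
    with residue-drops {{prime⇒nonZero p-prime}} i≤n large | ℕₚ.<⇒≤ p<n
  ... | inj₁ lt | p≤n = subst (_∣ₛ thePolyℤ n i) (ℕₚ.*-assoc p (n !) (n !))
    (∣ₛ-⋆ (p*n!∣ₛfalling p-prime p≤n (n ℕ.+ i) (+ 1) lt) (n!∣ₛfalling (2 ℕ.* n ∸ i) (ℤ.- (+ 1))))
  ... | inj₂ lt | p≤n = subst (_∣ₛ thePolyℤ n i) (swap (n !) p (n !))
    (∣ₛ-⋆ (n!∣ₛfalling (n ℕ.+ i) (+ 1)) (p*n!∣ₛfalling p-prime p≤n (2 ℕ.* n ∸ i) (ℤ.- (+ 1)) lt))
    where
    swap : ∀ a b c → a ℕ.* (b ℕ.* c) ≡ b ℕ.* (a ℕ.* c)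
    swap = ℕ-Solver.solve-∀

Φ̃n!²∣thePolyℤ : ∀ n H i → i ≤ n →
  + (tildePhi n ℕ.* (n ! ℕ.* n !)) ∣ᶻ (+ d n) ℤ.^ H ℤ.* thePolyℤ n i H
Φ̃n!²∣thePolyℤ n H i i≤n = Φ̃*M∣ n {{ℕₚ.m*n≢0 (n !) (n !) {{n ℕₚ.!≢0}} {{n ℕₚ.!≢0}}}}
  (n!²∣ₛthePolyℤ n i H) (λ P → p*n!²∣ₛthePolyℤ n i≤n P H)

module _ (n : ℕ) where

  private instance
    n!≢0 : NonZero (n !)
    n!≢0 = n ℕₚ.!≢0
    Φ̃≢0 : NonZero (tildePhi n)
    Φ̃≢0 = tildePhi-nonZero n

  1/n! 1/Φ̃ : ℚ
  1/n! = (+ 1) ℚ./ n !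
  1/Φ̃ = (+ 1) ℚ./ tildePhi n

  over-Φ̃n!² : ℤ → ℚ
  over-Φ̃n!² x = 1/Φ̃ ℚ.* (1/n! ℚ.* (1/n! ℚ.* fromℤ x))

  coeff-thePoly : ∀ i H → coeff (thePoly n i) H ≡ (1/n! ℚ.* 1/n!) ℚ.* fromℤ (thePolyℤ n i H)
  coeff-thePoly i H = begin
    coeff (B₁ ⊗ B₂) H
      ≡⟨ coeff-⊗ B₁ B₂ H ⟩
    (coeff B₁ ⋆ᵠ coeff B₂) H
      ≡⟨ ⋆ᵠ-cong (coeff-binomPoly _ _ n) (coeff-binomPoly _ _ n) H ⟩
    ((λ h → 1/n! ℚ.* fromℤ (F₁ h)) ⋆ᵠ (λ h → 1/n! ℚ.* fromℤ (F₂ h))) H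
      ≡⟨ ⋆ᵠ-scale 1/n! 1/n! (fromℤ ∘ F₁) (fromℤ ∘ F₂) H ⟩
    (1/n! ℚ.* 1/n!) ℚ.* ((fromℤ ∘ F₁) ⋆ᵠ (fromℤ ∘ F₂)) H
      ≡⟨ cong ((1/n! ℚ.* 1/n!) ℚ.*_) (fromℤ-⋆ F₁ F₂ H) ⟩
    (1/n! ℚ.* 1/n!) ℚ.* fromℤ (thePolyℤ n i H) ∎
    where
    open ≡-Reasoning
    B₁ B₂ : Poly
    B₁ = binomPoly (+ (n ℕ.+ i)) (+ 1) n
    B₂ = binomPoly (+ (2 ℕ.* n ∸ i)) (ℤ.- (+ 1)) n
    F₁ F₂ : ℕ → ℤ
    F₁ = falling (+ (n ℕ.+ i)) (+ 1) n
    F₂ = falling (+ (2 ℕ.* n ∸ i)) (ℤ.- (+ 1)) n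

  theNumber≡ : ∀ H i → theNumber n H i ≡ over-Φ̃n!² ((+ d n) ℤ.^ H ℤ.* thePolyℤ n i H)
  theNumber≡ H i = cong (1/Φ̃ ℚ.*_) (begin
    D^H ℚ.* taylorCoeff H (thePoly n i)
      ≡⟨ cong (D^H ℚ.*_) (trans (taylorCoeff≡coeff H (thePoly n i)) (coeff-thePoly i H)) ⟩
    D^H ℚ.* ((1/n! ℚ.* 1/n!) ℚ.* fromℤ (thePolyℤ n i H))
      ≡⟨ rearrange D^H 1/n! (fromℤ (thePolyℤ n i H)) ⟩
    1/n! ℚ.* (1/n! ℚ.* (D^H ℚ.* fromℤ (thePolyℤ n i H)))
      ≡⟨ cong (λ x → 1/n! ℚ.* (1/n! ℚ.* x)) (fromℤ-* (+ (d n ℕ.^ H)) (thePolyℤ n i H)) ⟨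
    1/n! ℚ.* (1/n! ℚ.* fromℤ (+ (d n ℕ.^ H) ℤ.* thePolyℤ n i H))
      ≡⟨ cong (λ x → 1/n! ℚ.* (1/n! ℚ.* fromℤ (x ℤ.* thePolyℤ n i H))) (pos-^ (d n) H) ⟩
    1/n! ℚ.* (1/n! ℚ.* fromℤ ((+ d n) ℤ.^ H ℤ.* thePolyℤ n i H)) ∎)
    where
    open ≡-Reasoning
    open +-*-Solver
    D^H : ℚ
    D^H = fromℤ (+ (d n ℕ.^ H))
    rearrange : ∀ a u c → a ℚ.* ((u ℚ.* u) ℚ.* c) ≡ u ℚ.* (u ℚ.* (a ℚ.* c))
    rearrange = solve 3 (λ a u c → a :* ((u :* u) :* c) := u :* (u :* (a :* c))) refl

  over-Φ̃n!²-cancel : ∀ z → over-Φ̃n!² (z ℤ.* + (tildePhi n ℕ.* (n ! ℕ.* n !))) ≡ fromℤ z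
  over-Φ̃n!²-cancel z = begin
    over-Φ̃n!² (z ℤ.* + (tildePhi n ℕ.* (n ! ℕ.* n !)))
      ≡⟨ cong over-Φ̃n!² split ⟩
    1/Φ̃ ℚ.* (1/n! ℚ.* (1/n! ℚ.* fromℤ ((zΦ̃ ℤ.* + (n !)) ℤ.* + (n !))))
      ≡⟨ cong (λ x → 1/Φ̃ ℚ.* (1/n! ℚ.* x)) (1/n*[z*n]≡z (n !) (zΦ̃ ℤ.* + (n !))) ⟩
    1/Φ̃ ℚ.* (1/n! ℚ.* fromℤ (zΦ̃ ℤ.* + (n !)))
      ≡⟨ cong (1/Φ̃ ℚ.*_) (1/n*[z*n]≡z (n !) zΦ̃) ⟩
    1/Φ̃ ℚ.* fromℤ zΦ̃
      ≡⟨ 1/n*[z*n]≡z (tildePhi n) z ⟩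
    fromℤ z ∎
    where
    open ≡-Reasoning
    zΦ̃ : ℤ
    zΦ̃ = z ℤ.* + tildePhi n
    reassoc : ∀ z a b c → z ℤ.* (a ℤ.* (b ℤ.* c)) ≡ ((z ℤ.* a) ℤ.* b) ℤ.* c
    reassoc = ℤ-Solver.solve-∀
    split : z ℤ.* + (tildePhi n ℕ.* (n ! ℕ.* n !)) ≡ (zΦ̃ ℤ.* + (n !)) ℤ.* + (n !)
    split = begin
      z ℤ.* + (tildePhi n ℕ.* (n ! ℕ.* n !))
        ≡⟨ cong (z ℤ.*_) (ℤₚ.pos-* (tildePhi n) (n ! ℕ.* n !)) ⟩
      z ℤ.* (+ tildePhi n ℤ.* + (n ! ℕ.* n !))
        ≡⟨ cong (λ x → z ℤ.* (+ tildePhi n ℤ.* x)) (ℤₚ.pos-* (n !) (n !)) ⟩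
      z ℤ.* (+ tildePhi n ℤ.* (+ (n !) ℤ.* + (n !)))
        ≡⟨ reassoc z (+ tildePhi n) (+ (n !)) (+ (n !)) ⟩
      (zΦ̃ ℤ.* + (n !)) ℤ.* + (n !) ∎

mainTheorem16 : ∀ (n H i : ℕ) → i ≤ n → ∃ λ (z : ℤ) → theNumber n H i ≡ fromℤ z
mainTheorem16 n H i i≤n = quotient , (begin
  theNumber n H i                                              ≡⟨ theNumber≡ n H i ⟩
  over-Φ̃n!² n ((+ d n) ℤ.^ H ℤ.* thePolyℤ n i H)               ≡⟨ cong (over-Φ̃n!² n) equality ⟩
  over-Φ̃n!² n (quotient ℤ.* + (tildePhi n ℕ.* (n ! ℕ.* n !)))  ≡⟨ over-Φ̃n!²-cancel n quotient ⟩
  fromℤ quotient                                               ∎)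
  where
  open ℤᵈ._∣_ (Φ̃n!²∣thePolyℤ n H i i≤n)
  open ≡-Reasoning
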